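{- Let $\preceq$ be an entrenchment relation satisfying Left Disjunction. Then for all $\alpha,\beta\in\mathcal{L}$: $\alpha\mathrel{|\!\sim_\preceq}\beta$ if and only if $\alpha\mathrel{|\!\sim^w_\preceq}\beta$.
   Context: $\mathcal{L}$ is the set of formulas of a propositional language closed under $\lor,\land,\neg,\to$. $\vdash\subseteq 2^{\mathcal{L}}\times\mathcal{L}$ is a fixed consequence relation including classical propositional logic, compact, satisfying the deduction theorem and disjunction in premises; $\alpha\vdash\beta$ means $\{\alpha\}\vdash\beta$; $\mathrm{Cn}(X)=\{\beta:X\vdash\beta\}$, $\mathrm{Cn}(X,\alpha)=\mathrm{Cn}(X\cup\{\alpha\})$. An entrenchment relation is a binary relation $\preceq$ on $\mathcal{L}$ such that for all $\alpha,\beta,\gamma$: $\alpha\preceq\alpha$; $\alpha\vdash\beta$ and $\beta\preceq\gamma$ imply $\alpha\preceq\gamma$; if $\alpha\vdash\beta$ and $\beta\vdash\alpha$ then $\gamma\preceq\alpha$ iff $\gamma\preceq\beta$. Left Disjunction: $\beta\preceq\alpha$ and $\gamma\preceq\alpha$ imply $\beta\lor\gamma\preceq\alpha$. $\mathrm{Coh}(\alpha)=\{\beta:\beta\not\preceq\neg\alpha\}$. Maxiconsistent inference: $\mathcal{B}(\alpha)$ = deductively closed $U$ with $U\subseteq\mathrm{Coh}(\alpha)$; $\mathcal{B}_{\max}(\alpha)$ = those $U\in\mathcal{B}(\alpha)$ with no deductively closed $U'\supsetneq U$ in $\mathcal{B}(\alpha)$; $E(\alpha)=\bigcap\{\mathrm{Cn}(U,\alpha):U\in\mathcal{B}_{\max}(\alpha)\}$;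 $\alpha\mathrel{|\!\sim_\preceq}\beta$ iff $\beta\in E(\alpha)$. Weak maxiconsistent inference: $U^\alpha=\{\alpha\to\beta:\beta\in U\}$; $\mathcal{B}^w(\alpha)$ = deductively closed $U$ with $U^\alpha\subseteq\mathrm{Coh}(\alpha)$; $\mathcal{B}^w_{\max}(\alpha)$ = those $U\in\mathcal{B}^w(\alpha)$ such that no deductively closed $V\in\mathcal{B}^w(\alpha)$ has $U^\alpha\subsetneq V^\alpha$; $E^w(\alpha)=\bigcap\mathcal{B}^w_{\max}(\alpha)$; $\alpha\mathrel{|\!\sim^w_\preceq}\beta$ iff $\beta\in E^w(\alpha)$. Intersections of empty families are $\mathcal{L}$. -}

module Defs where

open import Data.Bool using (Bool; true; false; _∧_; _∨_; not)
open import Data.Product using (Σ; _×_; _,_)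
open import Data.Sum using (_⊎_)
open import Data.List using (List)
open import Data.List.Relation.Unary.All using (All)
open import Data.List.Membership.Propositional using (_∈_)
open import Relation.Binary.PropositionalEquality using (_≡_)
open import Relation.Nullary using (¬_)
open import Function.Bundles using (_⇔_)

data Form (A : Set) : Set where
  atom : A → Form A
  _⋁_  : Form A → Form A → Form A
  _⋀_  : Form A → Form A → Form A
  ~_   : Form A → Form A
  _⇒_  : Form A → Form A → Form A

infixr 4 _⇒_
infixr 5 _⋁_
infixr 6 _⋀_
infix  7 ~_

Pred : Set → Set₁
Pred A = Form A → Set

module _ {A : Set} where

  _⊆_ : Pred A → Pred A → Set
  X ⊆ Y = ∀ φ → X φ → Y φ

  _⊊_ : Pred A → Pred A → Set
  X ⊊ Y = X ⊆ Y × ¬ (Y ⊆ X)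

  _∪｛_｝ : Pred A → Form A → Pred A
  (X ∪｛ α ｝) φ = X φ ⊎ (φ ≡ α)

  _∪_ : Pred A → Pred A → Pred A
  (X ∪ Y) φ = X φ ⊎ Y φ

  ｛_｝ : Form A → Pred A
  ｛ α ｝ φ = φ ≡ α

  listSet : List (Form A) → Pred A
  listSet xs φ = φ ∈ xs

  eval : (A → Bool) → Form A → Bool
  eval v (atom p) = v p
  eval v (φ ⋁ ψ)  = eval v φ ∨ eval v ψ
  eval v (φ ⋀ ψ)  = eval v φ ∧ eval v ψ
  eval v (~ φ)    = not (eval v φ)
  eval v (φ ⇒ ψ)  = not (eval v φ) ∨ eval v ψ

  _⊨_ : Pred A → Form A → Set
  X ⊨ α = ∀ (v : A → Bool) → (∀ φ → X φ → eval v φ ≡ true) → eval v α ≡ true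

record Consequence (A : Set) : Set₁ where
  field
    _⊢_          : Pred A → Form A → Set
    inclusion    : ∀ {X α} → X α → X ⊢ α
    monotony     : ∀ {X Y α} → X ⊆ Y → X ⊢ α → Y ⊢ α
    cut          : ∀ {X Y α} → (∀ ψ → Y ψ → X ⊢ ψ) → (X ∪ Y) ⊢ α → X ⊢ α
    supraclassical : ∀ {X α} → X ⊨ α → X ⊢ α
    compact      : ∀ {X α} → X ⊢ α →
                   Σ (List (Form A)) λ xs → All X xs × (listSet xs ⊢ α)
    deduction    : ∀ {X α β} → ((X ∪｛ α ｝) ⊢ β) ⇔ (X ⊢ (α ⇒ β))
    disjPremises : ∀ {X α β γ} → (X ∪｛ α ｝) ⊢ γ → (X ∪｛ β ｝) ⊢ γ →
                   (X ∪｛ α ⋁ β ｝) ⊢ γ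

module _ {A : Set} (C : Consequence A) where
  open Consequence C

  _⊢₁_ : Form A → Form A → Set
  α ⊢₁ β = ｛ α ｝ ⊢ β

  record IsEntrenchment (_⪯_ : Form A → Form A → Set) : Set where
    field
      ⪯-refl      : ∀ {α} → α ⪯ α
      ⪯-dominance : ∀ {α β γ} → α ⊢₁ β → β ⪯ γ → α ⪯ γ
      ⪯-equiv     : ∀ {α β γ} → α ⊢₁ β → β ⊢₁ α → (γ ⪯ α ⇔ γ ⪯ β)

  LeftDisjunction : (Form A → Form A → Set) → Set
  LeftDisjunction _⪯_ = ∀ {α β γ} → β ⪯ α → γ ⪯ α → (β ⋁ γ) ⪯ α

  module _ (_⪯_ : Form A → Form A → Set) where

    Coh : Form A → Pred A
    Coh α β = ¬ (β ⪯ (~ α))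

    Closed : Pred A → Set
    Closed U = ∀ β → U ⊢ β → U β

    𝓑 : Form A → Pred A → Set
    𝓑 α U = Closed U × (U ⊆ Coh α)

    𝓑max : Form A → Pred A → Set₁
    𝓑max α U = 𝓑 α U × ¬ (Σ (Pred A) λ U' → 𝓑 α U' × (U ⊊ U'))

    _|∼_ : Form A → Form A → Set₁
    α |∼ β = ∀ (U : Pred A) → 𝓑max α U → (U ∪｛ α ｝) ⊢ β

    _^_ : Pred A → Form A → Pred A
    (U ^ α) φ = Σ (Form A) λ β → U β × (φ ≡ (α ⇒ β))

    𝓑w : Form A → Pred A → Set
    𝓑w α U = Closed U × ((U ^ α) ⊆ Coh α)

    𝓑wmax : Form A → Pred A → Set₁
    𝓑wmax α U = 𝓑w α U × ¬ (Σ (Pred A) λ V → 𝓑w α V × ((U ^ α) ⊊ (V ^ α)))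

    _|∼ʷ_ : Form A → Form A → Set₁
    α |∼ʷ β = ∀ (U : Pred A) → 𝓑wmax α U → U β

{-# OPTIONS --safe #-}
-- For a maximal U ∈ 𝓑(α) the closure Cn(U, α) is again in 𝓑(α), because Left
-- Disjunction makes α → φ coherent with α exactly when φ is; maximality then
-- forces α ∈ U, so Cn(U, α) = U. The same equivalence of coherence shows that
-- U ↦ U^α identifies 𝓑(α) with 𝓑ʷ(α) and preserves strict inclusion, so both
-- inference relations are the intersection over the same maximal sets.
module Submission where

open import Defs
open import Data.Bool using (true; not; _∨_)
open import Data.Bool.Properties using (∨-zeroʳ) renaming (_≟_ to _≟ᵇ_)
open import Data.Product using (_,_)
open import Data.Sum using (inj₁; inj₂)
open import Function.Bundles using (_⇔_; mk⇔; Equivalence)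
open import Relation.Binary.PropositionalEquality using (_≡_; refl; subst; sym)
open import Relation.Nullary using (¬_)
open import Relation.Nullary.Decidable using (decidable-stable)

open Equivalence using (to; from)

⇒-injectiveʳ : {A : Set} {α β γ : Form A} → (α ⇒ β) ≡ (α ⇒ γ) → β ≡ γ
⇒-injectiveʳ refl = refl

module _ {A : Set} (C : Consequence A) where
  open Consequence C

  Cn : Pred A → Form A → Pred A
  Cn X α φ = (X ∪｛ α ｝) ⊢ φ

module _ {A : Set} (C : Consequence A) (_⪯_ : Form A → Form A → Set) where
  open Consequence C

  ^-⊆⇔⊆ : ∀ {α} {U V : Pred A} → (_^_ C _⪯_ U α ⊆ _^_ C _⪯_ V α) ⇔ (U ⊆ V)
  ^-⊆⇔⊆ {α} {U} {V} = mk⇔ shrink grow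
    where
    shrink : _^_ C _⪯_ U α ⊆ _^_ C _⪯_ V α → U ⊆ V
    shrink U^⊆V^ β Uβ with U^⊆V^ (α ⇒ β) (β , Uβ , refl)
    ... | γ , Vγ , α⇒β≡α⇒γ = subst V (sym (⇒-injectiveʳ α⇒β≡α⇒γ)) Vγ
    grow : U ⊆ V → _^_ C _⪯_ U α ⊆ _^_ C _⪯_ V α
    grow U⊆V φ (β , Uβ , φ≡α⇒β) = β , U⊆V β Uβ , φ≡α⇒β

  ^-⊊⇔⊊ : ∀ {α} {U V : Pred A} → (_^_ C _⪯_ U α ⊊ _^_ C _⪯_ V α) ⇔ (U ⊊ V)
  ^-⊊⇔⊊ = mk⇔ (λ (U^⊆V^ , V^⊈U^) → to ^-⊆⇔⊆ U^⊆V^ , λ V⊆U → V^⊈U^ (from ^-⊆⇔⊆ V⊆U))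
               (λ (U⊆V , V⊈U) → from ^-⊆⇔⊆ U⊆V , λ V^⊆U^ → V⊈U (to ^-⊆⇔⊆ V^⊆U^))

  Closed-stable : ∀ {U φ} → Closed C _⪯_ U → ¬ ¬ U φ → U φ
  Closed-stable {U} {φ} closed ¬¬Uφ = closed φ (supraclassical U⊨φ)
    where
    U⊨φ : U ⊨ φ
    U⊨φ v ⊨U = decidable-stable (eval v φ ≟ᵇ true) (λ φ≢true → ¬¬Uφ (λ Uφ → φ≢true (⊨U φ Uφ)))

  Cn-closed : ∀ U α → Closed C _⪯_ (Cn C U α)
  Cn-closed U α φ ⊢φ = cut (λ _ ⊢ψ → ⊢ψ) (monotony (λ _ → inj₂) ⊢φ)

  Cn-member : ∀ {U α β} → Closed C _⪯_ U → U α → Cn C U α β ⇔ U β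
  Cn-member closed Uα = mk⇔
    (λ ⊢β → closed _ (cut (λ { _ refl → inclusion Uα }) ⊢β))
    (λ Uβ → inclusion (inj₁ Uβ))

  module _ (isE : IsEntrenchment C _⪯_) (leftDisjunction : LeftDisjunction C _⪯_) where
    open IsEntrenchment isE

    -- Only the forward direction needs Left Disjunction: it lifts φ ⪯ ¬α to ¬α ∨ φ ⪯ ¬α.
    Coh-⇒⇔ : ∀ {α φ} → Coh C _⪯_ α (α ⇒ φ) ⇔ Coh C _⪯_ α φ
    Coh-⇒⇔ {α} {φ} = mk⇔
      (λ coh φ⪯¬α → coh (⪯-dominance ⇒⊢¬∨ (leftDisjunction ⪯-refl φ⪯¬α)))
      (λ coh α⇒φ⪯¬α → coh (⪯-dominance φ⊢α⇒φ α⇒φ⪯¬α))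
      where
      ⇒⊢¬∨ : _⊢₁_ C (α ⇒ φ) (~ α ⋁ φ)
      ⇒⊢¬∨ = supraclassical (λ _ ⊨α⇒φ → ⊨α⇒φ _ refl)
      φ⊢α⇒φ : _⊢₁_ C φ (α ⇒ φ)
      φ⊢α⇒φ = supraclassical λ v ⊨φ → subst (λ b → not (eval v α) ∨ b ≡ true)
                                            (sym (⊨φ φ refl)) (∨-zeroʳ (not (eval v α)))

    𝓑w⇔𝓑 : ∀ {α U} → 𝓑w C _⪯_ α U ⇔ 𝓑 C _⪯_ α U
    𝓑w⇔𝓑 = mk⇔
      (λ (closed , U^⊆Coh) → closed , λ φ Uφ → to Coh-⇒⇔ (U^⊆Coh _ (φ , Uφ , refl)))
      (λ (closed , U⊆Coh) → closed , λ { _ (φ , Uφ , refl) → from Coh-⇒⇔ (U⊆Coh φ Uφ) })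

    𝓑wmax⇔𝓑max : ∀ {α U} → 𝓑wmax C _⪯_ α U ⇔ 𝓑max C _⪯_ α U
    𝓑wmax⇔𝓑max = mk⇔
      (λ (bw , maximal) → to 𝓑w⇔𝓑 bw ,
                          λ (V , b , U⊊V) → maximal (V , from 𝓑w⇔𝓑 b , from ^-⊊⇔⊊ U⊊V))
      (λ (b , maximal) → from 𝓑w⇔𝓑 b ,
                         λ (V , bw , U^⊊V^) → maximal (V , to 𝓑w⇔𝓑 bw , to ^-⊊⇔⊊ U^⊊V^))

    Cn-𝓑 : ∀ {α U} → 𝓑 C _⪯_ α U → 𝓑 C _⪯_ α (Cn C U α)
    Cn-𝓑 {α} {U} (closed , U⊆Coh) = Cn-closed U α , Cn⊆Coh
      where
      Cn⊆Coh : Cn C U α ⊆ Coh C _⪯_ α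
      Cn⊆Coh φ ⊢φ = to Coh-⇒⇔ (U⊆Coh _ (closed _ (to deduction ⊢φ)))

    𝓑max-∋ : ∀ {α U} → 𝓑max C _⪯_ α U → U α
    𝓑max-∋ {α} {U} (b@(closed , _) , maximal) = Closed-stable closed λ α∉U →
      maximal (Cn C U α , Cn-𝓑 b , (λ _ Uφ → inclusion (inj₁ Uφ)) ,
               λ Cn⊆U → α∉U (Cn⊆U α (inclusion (inj₂ refl))))

    𝓑max-Cn : ∀ {α U β} → 𝓑max C _⪯_ α U → Cn C U α β ⇔ U β
    𝓑max-Cn max@((closed , _) , _) = Cn-member closed (𝓑max-∋ max)

mainTheorem9 : (A : Set) (C : Consequence A) (_⪯_ : Form A → Form A → Set) →
    IsEntrenchment C _⪯_ → LeftDisjunction C _⪯_ →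
    ∀ (α β : Form A) → (_|∼_ C _⪯_ α β ⇔ _|∼ʷ_ C _⪯_ α β)
mainTheorem9 A C _⪯_ isE leftDisjunction α β = mk⇔
  (λ |∼β U wmax → let max = to maximal-sets-agree wmax in to (Cn-agrees max) (|∼β U max))
  (λ |∼ʷβ U max → from (Cn-agrees max) (|∼ʷβ U (from maximal-sets-agree max)))
  where
  maximal-sets-agree : ∀ {U} → 𝓑wmax C _⪯_ α U ⇔ 𝓑max C _⪯_ α U
  maximal-sets-agree = 𝓑wmax⇔𝓑max C _⪯_ isE leftDisjunction
  Cn-agrees : ∀ {U} → 𝓑max C _⪯_ α U → Cn C U α β ⇔ U β
  Cn-agrees = 𝓑max-Cn C _⪯_ isE leftDisjunction
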